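{- Let $k$ be a nonzero integer. (i) Let $n$ be an odd integer with $n>2$. If $k>2^{n}+2$, then the equation $x^{2}-kxy+y^{2}=-2^{n}$ has no solution in positive integers $x,y$. If $k\leq 2^{n}+2$ and the equation $x^{2}-kxy+y^{2}=-2^{n}$ has a solution in positive integers $x,y$, then $k$ is even. (ii) Let $n$ be a positive even integer. If $k>2^{n}+2$, then the equation $x^{2}-kxy+y^{2}=-2^{n}$ has no solution in positive odd integers $x,y$. If $k\leq 2^{n}+2$ and the equation $x^{2}-kxy+y^{2}=-2^{n}$ has a solution in positive odd integers $x,y$, then $k$ is even and $2$ divides $k$ exactly, i.e. $k\equiv 2 \pmod 4$.
   Context: Throughout, $k$ is an integer, and the paper assumes $k\neq 0$. -}

module Defs where

open import Data.Nat as ℕ using (ℕ)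
open import Data.Integer using (ℤ; +_; -_; _+_; _*_; _-_; _^_)
open import Relation.Binary.PropositionalEquality using (_≡_)

Eqn : ℤ → ℕ → ℤ → ℤ → Set
Eqn k n x y = x * x - k * x * y + y * y ≡ - ((+ 2) ^ n)

{-# OPTIONS --safe #-}
-- For k ≥ 0 a positive solution of x² + y² + 2ⁿ = kxy can be moved by Vieta jumping
-- (x, y) ↦ (ky − x, y) to one with y ≤ x and x² ≤ y² + 2ⁿ, and there
-- kxy ≤ 2y² + 2·2ⁿ ≤ (2ⁿ + 2)xy.  For parity: if k is odd, x² − kxy + y² is odd unless
-- x and y are both even, and halving both lowers n by 2, so n must be even.  If x and y
-- are odd and 4 ∣ k, the form is 2 modulo 4, whereas 2ⁿ is 0 modulo 4 for n ≥ 2.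
module Submission where

open import Defs
open import Data.Nat as ℕ using (ℕ; zero; suc; s≤s)
open import Data.Product using (∃-syntax; ∃₂; _×_; _,_)
open import Relation.Binary.PropositionalEquality

module VietaDescent (N k : ℕ) where
  open import Data.Nat
  open import Data.Nat.Properties
  open import Data.Nat.Induction using (<-wellFounded)
  open import Data.Nat.Tactic.RingSolver using (solve)
  open import Data.List using (_∷_; [])
  open import Data.Sum using (inj₁; inj₂)
  open import Induction.WellFounded using (Acc; acc)
  open import Relation.Nullary using (yes; no)

  Solution : ℕ → ℕ → Set
  Solution x y = x * x + y * y + N ≡ k * x * y

  solution-sym : ∀ {x y} → Solution x y → Solution y x
  solution-sym {x} {y} sol = begin
    y * y + x * x + N ≡⟨ solve (x ∷ y ∷ N ∷ []) ⟩
    x * x + y * y + N ≡⟨ sol ⟩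
    k * x * y         ≡⟨ solve (k ∷ x ∷ y ∷ []) ⟩
    k * y * x         ∎
    where open ≡-Reasoning

  bound-at-base : ∀ {x y} → 1 ≤ y → y ≤ x → x * x ≤ y * y + N → Solution x y → k ≤ N + 2
  bound-at-base {1} {1} _ _ _ sol = ≤-reflexive (begin
    k         ≡⟨ solve (k ∷ []) ⟩
    k * 1 * 1 ≡⟨ sol ⟨
    2 + N     ≡⟨ +-comm 2 N ⟩
    N + 2     ∎)
    where open ≡-Reasoning
  bound-at-base {1} {suc (suc _)} _ (s≤s ()) _ _
  bound-at-base {x@(suc (suc _))} {y} 1≤y y≤x x²≤y²+N sol =
    *-cancelʳ-≤ k (N + 2) (x * y) {{>-nonZero 0<xy}} (begin
      k * (x * y)               ≡⟨ *-assoc k x y ⟨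
      k * x * y                 ≡⟨ sol ⟨
      x * x + y * y + N         ≤⟨ +-monoˡ-≤ N (+-monoˡ-≤ (y * y) x²≤y²+N) ⟩
      (y * y + N) + y * y + N   ≡⟨ solve (y ∷ N ∷ []) ⟩
      2 * (y * y) + N * 2       ≤⟨ +-mono-≤ (*-monoʳ-≤ 2 (*-monoˡ-≤ y y≤x)) (*-monoʳ-≤ N 2≤xy) ⟩
      2 * (x * y) + N * (x * y) ≡⟨ *-distribʳ-+ (x * y) 2 N ⟨
      (2 + N) * (x * y)         ≡⟨ cong (_* (x * y)) (+-comm 2 N) ⟩
      (N + 2) * (x * y)         ∎)
    where
    open ≤-Reasoning
    2≤xy : 2 ≤ x * y
    2≤xy = *-mono-≤ {2} {x} {1} {y} (s≤s (s≤s z≤n)) 1≤y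
    0<xy : 0 < x * y
    0<xy = ≤-trans (s≤s z≤n) 2≤xy

  root-product : ∀ {x x′ y} → x + x′ ≡ k * y → Solution x y → x * x′ ≡ y * y + N
  root-product {x} {x′} {y} x+x′≡ky sol = +-cancelˡ-≡ (x * x) _ _ (begin
    x * x + x * x′      ≡⟨ *-distribˡ-+ x x x′ ⟨
    x * (x + x′)        ≡⟨ cong (x *_) x+x′≡ky ⟩
    x * (k * y)         ≡⟨ solve (x ∷ k ∷ y ∷ []) ⟩
    k * x * y           ≡⟨ sol ⟨
    x * x + y * y + N   ≡⟨ +-assoc (x * x) (y * y) N ⟩
    x * x + (y * y + N) ∎)
    where open ≡-Reasoning

  other-root : ∀ {x x′ y} → x + x′ ≡ k * y → Solution x y → Solution x′ y
  other-root {x} {x′} {y} x+x′≡ky sol = begin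
    x′ * x′ + y * y + N   ≡⟨ +-assoc (x′ * x′) (y * y) N ⟩
    x′ * x′ + (y * y + N) ≡⟨ cong (x′ * x′ +_) (root-product x+x′≡ky sol) ⟨
    x′ * x′ + x * x′      ≡⟨ solve (x ∷ x′ ∷ []) ⟩
    x′ * (x + x′)         ≡⟨ cong (x′ *_) x+x′≡ky ⟩
    x′ * (k * y)          ≡⟨ solve (x′ ∷ k ∷ y ∷ []) ⟩
    k * x′ * y            ∎
    where open ≡-Reasoning

  vieta-jump : ∀ {x y} → 1 ≤ y → y * y + N < x * x → Solution x y →
               ∃[ x′ ] 1 ≤ x′ × x′ < x × Solution x′ y
  vieta-jump {x} {y} 1≤y y²+N<x² sol = x′ , 1≤x′ , x′<x , other-root x+x′≡ky sol
    where
    instance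
      x≢0 : NonZero x
      x≢0 = m*n≢0⇒m≢0 x {x} {{>-nonZero (≤-<-trans z≤n y²+N<x²)}}
    x≤ky : x ≤ k * y
    x≤ky = *-cancelˡ-≤ x (begin
      x * x               ≤⟨ m≤m+n (x * x) (y * y + N) ⟩
      x * x + (y * y + N) ≡⟨ +-assoc (x * x) (y * y) N ⟨
      x * x + y * y + N   ≡⟨ sol ⟩
      k * x * y           ≡⟨ solve (k ∷ x ∷ y ∷ []) ⟩
      x * (k * y)         ∎)
      where open ≤-Reasoning
    x′ = k * y ∸ x
    x+x′≡ky : x + x′ ≡ k * y
    x+x′≡ky = m+[n∸m]≡n x≤ky
    xx′≡y²+N : x * x′ ≡ y * y + N
    xx′≡y²+N = root-product x+x′≡ky sol
    x′<x : x′ < x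
    x′<x = *-cancelˡ-< x x′ x (subst (_< x * x) (sym xx′≡y²+N) y²+N<x²)
    0<xx′ : 0 < x * x′
    0<xx′ = subst (0 <_) (sym xx′≡y²+N) (≤-trans (*-mono-≤ 1≤y 1≤y) (m≤m+n (y * y) N))
    1≤x′ : 1 ≤ x′
    1≤x′ = >-nonZero⁻¹ x′ {{m*n≢0⇒n≢0 x {{>-nonZero 0<xx′}}}}

  solution-bound-acc : ∀ {x y} → Acc _<_ x → 1 ≤ y → y ≤ x → Solution x y → k ≤ N + 2
  solution-bound-acc {x} {y} (acc rec) 1≤y y≤x sol with x * x ≤? y * y + N
  ... | yes x²≤y²+N = bound-at-base 1≤y y≤x x²≤y²+N sol
  ... | no x²≰y²+N with vieta-jump 1≤y (≰⇒> x²≰y²+N) sol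
  ... | x′ , 1≤x′ , x′<x , sol′ with ≤-total y x′
  ...   | inj₁ y≤x′ = solution-bound-acc (rec x′<x) 1≤y y≤x′ sol′
  ...   | inj₂ x′≤y = solution-bound-acc (rec y<x) 1≤x′ x′≤y (solution-sym sol′)
    where
    y<x : y < x
    y<x = ≰⇒> λ x≤y → x²≰y²+N (≤-trans (*-mono-≤ x≤y x≤y) (m≤m+n (y * y) N))

  solution-bound : ∀ {x y} → 1 ≤ x → 1 ≤ y → Solution x y → k ≤ N + 2
  solution-bound {x} {y} 1≤x 1≤y sol with ≤-total y x
  ... | inj₁ y≤x = solution-bound-acc (<-wellFounded x) 1≤y y≤x sol
  ... | inj₂ x≤y = solution-bound-acc (<-wellFounded y) 1≤x x≤y (solution-sym sol)

import Data.Nat.Properties as ℕ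
open import Data.Nat.Divisibility as ℕ∣ using () renaming (_∣_ to _∣ℕ_)
open import Data.Integer using (ℤ; +_; -_; _+_; _*_; _-_; _^_; ∣_∣; _≤_; _>_; 0ℤ; -1ℤ; +<+; +≤+; -≤+; -[1+_])
open import Data.Integer.Properties
open import Data.Integer.DivMod using (_/_; a≡a%n+[a/n]*n; n%d<d)
open import Data.Integer.Divisibility using (_∣_)
open import Data.Integer.Divisibility.Signed using (divides; ∣ᵤ⇒∣; ∣⇒∣ᵤ)
open import Data.Integer.Tactic.RingSolver using (solve-∀)
open import Data.Empty using (⊥-elim)
open import Relation.Nullary using (¬_)

form : ℤ → ℤ → ℤ → ℤ
form k x y = x * x - k * x * y + y * y
-- INLINE lets the ring solver see through form.
{-# INLINE form #-}

data Parity : ℤ → Set where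
  even : ∀ a → Parity (+ 2 * a)
  odd  : ∀ a → Parity (+ 1 + + 2 * a)

parity : ∀ x → Parity x
parity x = parity-of-remainder (x / + 2) (n%d<d x (+ 2)) (a≡a%n+[a/n]*n x (+ 2))
  where
  parity-of-remainder : ∀ {x r} q → r ℕ.< 2 → x ≡ + r + q * + 2 → Parity x
  parity-of-remainder {r = 0} q _ refl = subst Parity (sym (trans (+-identityˡ (q * + 2)) (*-comm q (+ 2)))) (even q)
  parity-of-remainder {r = 1} q _ refl = subst Parity (cong (_+_ (+ 1)) (*-comm (+ 2) q)) (odd q)
  parity-of-remainder {r = suc (suc _)} q (s≤s (s≤s ())) _

2∣double : ∀ a → + 2 ∣ + 2 * a
2∣double a = ∣⇒∣ᵤ (divides a (*-comm (+ 2) a))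

Odd : ℤ → Set
Odd z = ∃[ c ] z ≡ + 1 + + 2 * c

odd≢even : ∀ a b → + 1 + + 2 * a ≢ + 2 * b
odd≢even a b 1+2a≡2b = ℕ.even≢odd ∣ b - a ∣ 0 (begin
  2 ℕ.* ∣ b - a ∣             ≡⟨ abs-* (+ 2) (b - a) ⟨
  ∣ + 2 * (b - a) ∣           ≡⟨ cong ∣_∣ (double-difference a b) ⟩
  ∣ + 2 * b - + 2 * a ∣       ≡⟨ cong (λ z → ∣ z - + 2 * a ∣) 1+2a≡2b ⟨
  ∣ + 1 + + 2 * a - + 2 * a ∣ ≡⟨ cong ∣_∣ (cancel-double a) ⟩
  1                           ∎)
  where
  open ≡-Reasoning
  double-difference : ∀ a b → + 2 * (b - a) ≡ + 2 * b - + 2 * a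
  double-difference = solve-∀
  cancel-double : ∀ a → + 1 + + 2 * a - + 2 * a ≡ + 1
  cancel-double = solve-∀

odd≢neg-pow : ∀ {z} n → Odd z → z ≢ - ((+ 2) ^ suc n)
odd≢neg-pow n (c , refl) eq = odd≢even c (- ((+ 2) ^ n)) (trans eq (neg-distribʳ-* (+ 2) ((+ 2) ^ n)))

form-sym : ∀ k x y → form k x y ≡ form k y x
form-sym = solve-∀

form-double : ∀ k a b → form k (+ 2 * a) (+ 2 * b) ≡ + 2 * (+ 2 * form k a b)
form-double = solve-∀

form-odd-odd-even : ∀ m a b → form (+ 1 + + 2 * m) (+ 1 + + 2 * a) (+ 2 * b)
  ≡ + 1 + + 2 * (+ 2 * a + + 2 * a * a - (+ 1 + + 2 * m) * (+ 1 + + 2 * a) * b + + 2 * b * b)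
form-odd-odd-even = solve-∀

form-odd-odd-odd : ∀ m a b → form (+ 1 + + 2 * m) (+ 1 + + 2 * a) (+ 1 + + 2 * b)
  ≡ + 1 + + 2 * (a + b + + 2 * a * a + + 2 * b * b - + 2 * a * b - m * (+ 1 + + 2 * a) * (+ 1 + + 2 * b))
form-odd-odd-odd = solve-∀

form-4∣-odd-odd : ∀ q a b → form (q * + 4) (+ 1 + + 2 * a) (+ 1 + + 2 * b)
  ≡ + 2 * (+ 1 + + 2 * (a + a * a + b + b * b - q * (+ 1 + + 2 * a) * (+ 1 + + 2 * b)))
form-4∣-odd-odd = solve-∀

-- The witnesses are explicit: ℤ multiplication unfolds, so Agda cannot read them off the identities.
odd-k-odd-x⇒form-odd : ∀ m a y → Odd (form (+ 1 + + 2 * m) (+ 1 + + 2 * a) y)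
odd-k-odd-x⇒form-odd m a y with parity y
... | even b = + 2 * a + + 2 * a * a - (+ 1 + + 2 * m) * (+ 1 + + 2 * a) * b + + 2 * b * b
             , form-odd-odd-even m a b
... | odd b  = a + b + + 2 * a * a + + 2 * b * b - + 2 * a * b - m * (+ 1 + + 2 * a) * (+ 1 + + 2 * b)
             , form-odd-odd-odd m a b

halve-neg-power : ∀ {z} n → + 2 * z ≡ - ((+ 2) ^ suc n) → z ≡ - ((+ 2) ^ n)
halve-neg-power {z} n eq = *-cancelˡ-≡ (+ 2) z _ (trans eq (neg-distribʳ-* (+ 2) ((+ 2) ^ n)))

data BothEven : ℤ → ℤ → Set where
  both-even : ∀ a b → BothEven (+ 2 * a) (+ 2 * b)

odd-k⇒both-even : ∀ m n x y → Eqn (+ 1 + + 2 * m) (suc n) x y → BothEven x y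
odd-k⇒both-even m n x y eq with parity x | parity y
... | even a | even b = both-even a b
... | odd a  | _      = ⊥-elim (odd≢neg-pow n (odd-k-odd-x⇒form-odd m a y) eq)
... | even a | odd b  = ⊥-elim (odd≢neg-pow n (odd-k-odd-x⇒form-odd m b (+ 2 * a))
                          (trans (form-sym (+ 1 + + 2 * m) (+ 1 + + 2 * b) (+ 2 * a)) eq))

halve-solution : ∀ k n a b → Eqn k (suc n) (+ 2 * a) (+ 2 * b) → + 2 * form k a b ≡ - ((+ 2) ^ n)
halve-solution k n a b eq = halve-neg-power n (trans (sym (form-double k a b)) eq)

odd-k⇒even-exponent : ∀ m n x y → Eqn (+ 1 + + 2 * m) n x y → 2 ∣ℕ n
odd-k⇒even-exponent m zero _ _ _ = 2 ℕ∣.∣0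
odd-k⇒even-exponent m (suc n) x y eq with odd-k⇒both-even m n x y eq
odd-k⇒even-exponent m 1 _ _ eq | both-even a b = ⊥-elim (odd≢even -1ℤ _ (sym (halve-solution (+ 1 + + 2 * m) 0 a b eq)))
odd-k⇒even-exponent m (suc (suc n)) _ _ eq | both-even a b =
  ℕ∣.∣m∣n⇒∣m+n ℕ∣.∣-refl (odd-k⇒even-exponent m n a b (halve-neg-power n (halve-solution (+ 1 + + 2 * m) (suc n) a b eq)))

4∣k⇒no-odd-solution : ∀ k n a b → + 4 ∣ k → ¬ Eqn k (suc (suc n)) (+ 1 + + 2 * a) (+ 1 + + 2 * b)
4∣k⇒no-odd-solution k n a b 4∣k eq with ∣ᵤ⇒∣ {+ 4} {k} 4∣k
... | divides q refl = odd≢neg-pow n (a + a * a + b + b * b - q * (+ 1 + + 2 * a) * (+ 1 + + 2 * b) , refl)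
  (halve-neg-power (suc n) (trans (sym (form-4∣-odd-odd q a b)) eq))

odd-solution⇒k≡2-mod-4 : ∀ k n x y → 2 ℕ.≤ n → ¬ (+ 2 ∣ x) → ¬ (+ 2 ∣ y) → Eqn k n x y →
                         (+ 2 ∣ k) × ¬ (+ 4 ∣ k)
odd-solution⇒k≡2-mod-4 _ 1 _ _ (s≤s ()) _ _ _
odd-solution⇒k≡2-mod-4 k (suc (suc n)) x y _ 2∤x 2∤y eq with parity x | parity y | parity k
... | even a | _      | _      = ⊥-elim (2∤x (2∣double a))
... | odd a  | even b | _      = ⊥-elim (2∤y (2∣double b))
... | odd a  | odd b  | odd m  = ⊥-elim (odd≢neg-pow (suc n) (odd-k-odd-x⇒form-odd m a (+ 1 + + 2 * b)) eq)
... | odd a  | odd b  | even c = 2∣double c , λ 4∣k → 4∣k⇒no-odd-solution (+ 2 * c) n a b 4∣k eq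

odd-exponent⇒even-k : ∀ k n x y → ¬ (2 ∣ℕ n) → Eqn k n x y → + 2 ∣ k
odd-exponent⇒even-k k n x y 2∤n eq with parity k
... | even c = 2∣double c
... | odd m  = ⊥-elim (2∤n (odd-k⇒even-exponent m n x y eq))

pos-^ : ∀ m n → (+ m) ^ n ≡ + (m ℕ.^ n)
pos-^ m zero    = refl
pos-^ m (suc n) = trans (cong (+ m *_) (pos-^ m n)) (sym (pos-* m (m ℕ.^ n)))

Eqn⇒x²+y²+2ⁿ≡kxy : ∀ k n x y → Eqn k n x y → x * x + y * y + (+ 2) ^ n ≡ k * x * y
Eqn⇒x²+y²+2ⁿ≡kxy k n x y eq = begin
  x * x + y * y + (+ 2) ^ n                           ≡⟨ regroup (x * x) (k * x * y) (y * y) ((+ 2) ^ n) ⟩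
  (x * x - k * x * y + y * y) + (+ 2) ^ n + k * x * y ≡⟨ cong (λ w → w + (+ 2) ^ n + k * x * y) eq ⟩
  - (+ 2) ^ n + (+ 2) ^ n + k * x * y                 ≡⟨ cong (_+ k * x * y) (+-inverseˡ ((+ 2) ^ n)) ⟩
  0ℤ + k * x * y                                      ≡⟨ +-identityˡ (k * x * y) ⟩
  k * x * y                                           ∎
  where
  open ≡-Reasoning
  regroup : ∀ X K Y M → X + Y + M ≡ (X - K + Y) + M + K
  regroup = solve-∀

Eqn⇒Solution : ∀ c n a b → Eqn (+ c) n (+ a) (+ b) → VietaDescent.Solution (2 ℕ.^ n) c a b
Eqn⇒Solution c n a b eq = +-injective (begin
  + (a ℕ.* a ℕ.+ b ℕ.* b ℕ.+ 2 ℕ.^ n)   ≡⟨ pos-+ (a ℕ.* a ℕ.+ b ℕ.* b) (2 ℕ.^ n) ⟩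
  + (a ℕ.* a ℕ.+ b ℕ.* b) + + 2 ℕ.^ n   ≡⟨ cong₂ _+_ (pos-+ (a ℕ.* a) (b ℕ.* b)) (sym (pos-^ 2 n)) ⟩
  + (a ℕ.* a) + + (b ℕ.* b) + (+ 2) ^ n ≡⟨ cong₂ (λ u v → u + v + (+ 2) ^ n) (pos-* a a) (pos-* b b) ⟩
  + a * + a + + b * + b + (+ 2) ^ n     ≡⟨ Eqn⇒x²+y²+2ⁿ≡kxy (+ c) n (+ a) (+ b) eq ⟩
  + c * + a * + b                       ≡⟨ cong (_* + b) (pos-* c a) ⟨
  + (c ℕ.* a) * + b                     ≡⟨ pos-* (c ℕ.* a) b ⟨
  + (c ℕ.* a ℕ.* b)                     ∎)
  where open ≡-Reasoning

positive-solution-bound : ∀ k n x y → x > 0ℤ → y > 0ℤ → Eqn k n x y → k ≤ (+ 2) ^ n + + 2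
positive-solution-bound k n x y x>0 y>0 eq =
  subst (k ≤_) (sym (trans (cong (_+ + 2) (pos-^ 2 n)) (sym (pos-+ (2 ℕ.^ n) 2)))) (bound k x y x>0 y>0 eq)
  where
  bound : ∀ k x y → x > 0ℤ → y > 0ℤ → Eqn k n x y → k ≤ + (2 ℕ.^ n ℕ.+ 2)
  bound -[1+ _ ] _ _ _ _ _ = -≤+
  bound (+ c) (+ a) (+ b) (+<+ 0<a) (+<+ 0<b) eq =
    +≤+ (VietaDescent.solution-bound (2 ℕ.^ n) c 0<a 0<b (Eqn⇒Solution c n a b eq))

theorem3p2 : (k : ℤ) → k ≢ 0ℤ →
    ((n : ℕ) → ¬ (2 ∣ℕ n) → 2 ℕ.< n →
      ((k > ((+ 2) ^ n) + + 2) → ¬ (∃₂ λ x y → x > 0ℤ × y > 0ℤ × Eqn k n x y))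
      × ((k ≤ ((+ 2) ^ n) + + 2) → (∃₂ λ x y → x > 0ℤ × y > 0ℤ × Eqn k n x y) → + 2 ∣ k))
    × ((n : ℕ) → 2 ∣ℕ n → 0 ℕ.< n →
      ((k > ((+ 2) ^ n) + + 2) → ¬ (∃₂ λ x y → x > 0ℤ × y > 0ℤ × ¬ (+ 2 ∣ x) × ¬ (+ 2 ∣ y) × Eqn k n x y))
      × ((k ≤ ((+ 2) ^ n) + + 2) → (∃₂ λ x y → x > 0ℤ × y > 0ℤ × ¬ (+ 2 ∣ x) × ¬ (+ 2 ∣ y) × Eqn k n x y) → (+ 2 ∣ k) × ¬ (+ 4 ∣ k)))
theorem3p2 k _ =
    (λ n 2∤n _ →
        (λ k>bound (x , y , x>0 , y>0 , eq) → <⇒≱ k>bound (positive-solution-bound k n x y x>0 y>0 eq))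
      , (λ _ (x , y , _ , _ , eq) → odd-exponent⇒even-k k n x y 2∤n eq))
  , (λ n 2∣n 0<n →
        (λ k>bound (x , y , x>0 , y>0 , _ , _ , eq) → <⇒≱ k>bound (positive-solution-bound k n x y x>0 y>0 eq))
      , (λ _ (x , y , _ , _ , 2∤x , 2∤y , eq) →
           odd-solution⇒k≡2-mod-4 k n x y (ℕ∣.∣⇒≤ {{ℕ.>-nonZero 0<n}} 2∣n) 2∤x 2∤y eq))
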